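{- Let $P$ be a poset of height $2$ on $2n$ elements with an odd number of linear extensions. Then \[ (n!)^2\le e(P)\le n!\,(2n-1)!!. \]
   Context: A poset has height $2$ if every chain has at most two elements. $e(P)$ denotes the number of linear extensions of $P$ (bijections $\ell:X\to[|X|]$ with $\ell(x)<\ell(y)$ whenever $x\prec y$). $(2n-1)!!=1\cdot3\cdot5\cdots(2n-1)$. -}

module Defs where

open import Data.Nat using (ℕ; zero; suc; _*_; _+_)
open import Data.Fin using (Fin; zero; suc; toℕ)
open import Data.Fin.Properties using (_≟_)
open import Data.List using (List; []; _∷_; map; concatMap; filter; length; allFin)
open import Data.Product using (_×_; _,_)
open import Relation.Binary.Core using (Rel)
open import Relation.Binary.Definitions using (Decidable)
open import Relation.Nullary using (¬_; Dec; yes; no)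
open import Relation.Nullary.Decidable using (_×-dec_)
open import Relation.Unary using (Pred)
open import Data.Fin.Properties using (all?)
open import Relation.Binary.PropositionalEquality using (_≡_)

record StrictPoset (m : ℕ) : Set₁ where
  field
    _≺_     : Rel (Fin m) _
    _≺?_    : Decidable _≺_
    irrefl  : ∀ x → ¬ (x ≺ x)
    trans   : ∀ {x y z} → x ≺ y → y ≺ z → x ≺ z

HasHeight≤2 : ∀ {m} → StrictPoset m → Set
HasHeight≤2 P = ∀ x y z → x ≺ y → y ≺ z → ⊥'
  where open StrictPoset P
        open import Data.Empty renaming (⊥ to ⊥')

allFuns : (m k : ℕ) → List (Fin m → Fin k)
allFuns zero    k = (λ ()) ∷ []
allFuns (suc m) k = concatMap (λ i → map (λ f → λ { zero → i ; (suc x) → f x }) (allFuns m k)) (allFin k)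

Injective : ∀ {m} → (Fin m → Fin m) → Set
Injective ℓ = ∀ x y → ℓ x ≡ ℓ y → x ≡ y

-- A linear extension: a bijection ℓ : X → [|X|] (here Fin m → Fin m; injective
-- self-maps of a finite set are exactly the bijections) with ℓ x < ℓ y whenever x ≺ y.
IsLinearExtension : ∀ {m} → StrictPoset m → (Fin m → Fin m) → Set
IsLinearExtension P ℓ = Injective ℓ × (∀ x y → x ≺ y → toℕ (ℓ x) Data.Nat.< toℕ (ℓ y))
  where open StrictPoset P
        import Data.Nat

isLinearExtension? : ∀ {m} (P : StrictPoset m) ℓ → Dec (IsLinearExtension P ℓ)
isLinearExtension? P ℓ =
  all? (λ x → all? (λ y → impl (ℓ x ≟ ℓ y) (x ≟ y)))
  ×-dec all? (λ x → all? (λ y → impl' (x ≺? y) (toℕ (ℓ x) Data.Nat.<? toℕ (ℓ y))))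
  where
    open StrictPoset P
    import Data.Nat
    open import Relation.Nullary.Decidable using (_→-dec_)
    impl : ∀ {A B : Set} → Dec A → Dec B → Dec (A → B)
    impl = _→-dec_
    impl' : ∀ {A B : Set} → Dec A → Dec B → Dec (A → B)
    impl' = _→-dec_

e : ∀ {m} → StrictPoset m → ℕ
e {m} P = length (filter (isLinearExtension? P) (allFuns m m))

-- double factorial (2n-1)!! = 1·3·5···(2n-1); oddDoubleFact 0 = 1.
oddDoubleFact : ℕ → ℕ
oddDoubleFact zero    = 1
oddDoubleFact (suc n) = (2 * n + 1) * oddDoubleFact n

-- Odd e(P) yields a linear extension ℓ₀ in which the elements at positions 2k and 2k+1
-- are related for every k: treating k = 0, 1, … in turn, the extensions matched at the
-- earlier pairs but not at pair k come in couples exchanged by transposing the positions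
-- 2k and 2k+1, so e(P) has the parity of the number of extensions matched at every pair.
-- Such an ℓ₀ gives a perfect matching bₖ ≺ tₖ, and since P has height 2 every relation goes
-- from some bₖ to some tₖ.  Listing the bₖ in any order and then the tₖ in any order gives
-- n!·n! linear extensions; conversely every linear extension puts each bₖ before tₖ, and
-- exactly (2n)!/2ⁿ = n!·(2n−1)!! bijections do so.

module Submission where

open import Data.Empty using (⊥-elim)
import Data.Fin as Fin
import Data.Fin.Properties as Fin
open import Data.Fin using (Fin; zero; suc; toℕ; punchIn; punchOut; _↑ˡ_; _↑ʳ_; splitAt; join; cast; combine; remQuot)
open import Data.Fin.Patterns using (0F; 1F)
open import Data.Fin.Permutation.Components using (transpose)
open import Data.Fin.Properties
  using ( _≟_; all?; any?; pigeonhole; suc-injective; 0≢1+n; ¬Fin0; <⇒≢; ≤∧≢⇒<; toℕ<n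
        ; punchIn-injective; punchOut-injective; punchInᵢ≢i; cast-involutive; toℕ-cast
        ; remQuot-combine; combine-remQuot; toℕ-combine; toℕ-↑ˡ; toℕ-↑ʳ; ↑ˡ-injective; ↑ʳ-injective; join-splitAt)
open import Data.List using (List; []; _∷_; _++_; map; concat; filter; length; allFin)
open import Data.List.Membership.Propositional.Properties using (∈-allFin)
open import Data.List.Membership.Setoid.Properties using (∈-filter⁺)
open import Data.List.Properties
  using (filter-≐; filter-all; filter-none; filter-++; length-++; length-removeAt′; length-tabulate; map-cong; map-∘)
open import Data.List.Relation.Unary.All as All using (All; []; _∷_)
import Data.List.Relation.Unary.All.Properties as All
open import Data.List.Relation.Unary.AllPairs as AllPairs using (AllPairs; []; _∷_)
import Data.List.Relation.Unary.AllPairs.Properties as AllPairs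
open import Data.List.Relation.Unary.Any as Any using (Any; here; there; _─_)
import Data.List.Relation.Unary.Any.Properties as Any
open import Data.List.Relation.Unary.Unique.Propositional using (Unique)
open import Data.List.Relation.Unary.Unique.Propositional.Properties using (allFin⁺)
open import Data.Nat using (ℕ; zero; suc; _+_; _*_; _^_; _!; _%_; _≤_; _<_; z≤n; s≤s)
import Data.Nat as ℕ
open import Data.Nat.Divisibility using (_∣_; divides)
open import Data.Nat.DivMod using ([m+kn]%n≡m%n)
open import Data.Nat.ListAction using (sum)
import Data.Nat.Properties as ℕ
open import Data.Nat.Solver using (module +-*-Solver)
open import Data.Product using (_×_; _,_; proj₁; proj₂; Σ; ∃₂; uncurry)
open import Data.Product.Properties using (,-injectiveˡ; ,-injectiveʳ)
open import Data.Sum using (inj₁; inj₂)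
import Data.Vec.Functional as Vector
open import Function using (_∘_; id)
open import Level using (0ℓ)
open import Relation.Binary using (Setoid; _Respects_)
open import Relation.Binary.PropositionalEquality
  using (_≡_; _≢_; _≗_; refl; sym; trans; cong; cong₂; subst; subst₂; _→-setoid_; module ≡-Reasoning)
open import Relation.Nullary using (¬_; ¬?; Dec; yes; no; contradiction)
open import Relation.Nullary.Decidable using (_→-dec_; _×-dec_)
open import Relation.Unary using (Pred; Decidable; _⊆_; _≐_; _∩_; ∁)
open import Relation.Unary.Properties using (_∩?_; ∁?)

open import Defs

open +-*-Solver using (solve; _:+_; _:*_; _:=_; con)

private
  variable
    m k m′ k′ : ℕ

module _ {a ℓ} (S : Setoid a ℓ) where
  open Setoid S using (_≈_) renaming (sym to ≈-sym; trans to ≈-trans)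
  open import Data.List.Membership.Setoid S using (_∈_)

  ∈-─ : ∀ {x y ys} (x∈ys : x ∈ ys) → y ∈ ys → ¬ y ≈ x → y ∈ (ys ─ x∈ys)
  ∈-─ (here x≈z)   (here y≈z)   y≉x = contradiction (≈-trans y≈z (≈-sym x≈z)) y≉x
  ∈-─ (here _)     (there y∈ys) _   = y∈ys
  ∈-─ (there _)    (here y≈z)   _   = here y≈z
  ∈-─ (there x∈ys) (there y∈ys) y≉x = there (∈-─ x∈ys y∈ys y≉x)

  unique-length-≤ : ∀ {xs ys} → AllPairs (λ x y → ¬ x ≈ y) xs → All (_∈ ys) xs →
                    length xs ≤ length ys
  unique-length-≤ []                  []                = z≤n
  unique-length-≤ {ys = ys} (x≉xs ∷ xs!) (x∈ys ∷ xs⊆ys) =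
    subst (_ ≤_) (sym (length-removeAt′ ys (Any.index x∈ys)))
      (s≤s (unique-length-≤ xs! (All.zipWith (λ (y≉x , y∈ys) → ∈-─ x∈ys y∈ys (y≉x ∘ ≈-sym)) (x≉xs , xs⊆ys))))

module _ {a b p} {A : Set a} {B : Set b} {P : Pred A p} (f : ∀ {x} → P x → B) where

  length-reduce : ∀ {xs} (pxs : All P xs) → length (All.reduce f pxs) ≡ length xs
  length-reduce []         = refl
  length-reduce (px ∷ pxs) = cong suc (length-reduce pxs)

  all-reduce : ∀ {q t} {Q : Pred A q} {T : Pred B t} → (∀ {x} (px : P x) → Q x → T (f px)) →
               ∀ {xs} (pxs : All P xs) → All Q xs → All T (All.reduce f pxs)
  all-reduce g []         []         = []
  all-reduce g (px ∷ pxs) (qx ∷ qxs) = g px qx ∷ all-reduce g pxs qxs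

  allPairs-reduce : ∀ {r s} {R : A → A → Set r} {S : B → B → Set s} →
                    (∀ {x y} (px : P x) (py : P y) → R x y → S (f px) (f py)) →
                    ∀ {xs} (pxs : All P xs) → AllPairs R xs → AllPairs S (All.reduce f pxs)
  allPairs-reduce g []         []           = []
  allPairs-reduce g (px ∷ pxs) (rxs ∷ rxss) =
    all-reduce (λ py rxy → g px py rxy) pxs rxs ∷ allPairs-reduce g pxs rxss

module _ {a p q} {A : Set a} {P : Pred A p} {Q : Pred A q} (P? : Decidable P) (Q? : Decidable Q) where

  length-filter-mono : P ⊆ Q → ∀ xs → length (filter P? xs) ≤ length (filter Q? xs)
  length-filter-mono P⊆Q []       = z≤n
  length-filter-mono P⊆Q (x ∷ xs) with P? x | Q? x
  ... | yes _  | yes _  = s≤s (length-filter-mono P⊆Q xs)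
  ... | yes px | no ¬qx = contradiction (P⊆Q px) ¬qx
  ... | no _   | yes _  = ℕ.≤-trans (length-filter-mono P⊆Q xs) (ℕ.n≤1+n _)
  ... | no _   | no _   = length-filter-mono P⊆Q xs

  length-filter-split : ∀ xs →
    length (filter P? xs) ≡ length (filter (P? ∩? Q?) xs) + length (filter (P? ∩? ∁? Q?) xs)
  length-filter-split []       = refl
  length-filter-split (x ∷ xs) with P? x | Q? x
  ... | yes _ | yes _ = cong suc (length-filter-split xs)
  ... | yes _ | no _  = trans (cong suc (length-filter-split xs)) (sym (ℕ.+-suc _ _))
  ... | no _  | yes _ = length-filter-split xs
  ... | no _  | no _  = length-filter-split xs

module _ {a p} {A : Set a} {P : Pred A p} (P? : Decidable P) where

  length-filter-concat : ∀ xss → length (filter P? (concat xss)) ≡ sum (map (length ∘ filter P?) xss)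
  length-filter-concat []         = refl
  length-filter-concat (xs ∷ xss) = begin
    length (filter P? (xs ++ concat xss))                       ≡⟨ cong length (filter-++ P? xs (concat xss)) ⟩
    length (filter P? xs ++ filter P? (concat xss))             ≡⟨ length-++ (filter P? xs) ⟩
    length (filter P? xs) + length (filter P? (concat xss))     ≡⟨ cong (_ +_) (length-filter-concat xss) ⟩
    length (filter P? xs) + sum (map (length ∘ filter P?) xss)  ∎
    where open ≡-Reasoning

  length-filter-map : ∀ {b} {B : Set b} (f : B → A) xs → length (filter P? (map f xs)) ≡ length (filter (P? ∘ f) xs)
  length-filter-map f []       = refl
  length-filter-map f (x ∷ xs) with P? (f x)
  ... | yes _ = cong suc (length-filter-map f xs)
  ... | no _  = length-filter-map f xs

module _ {a} {A : Set a} where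

  sum-map-const : ∀ c (xs : List A) → sum (map (λ _ → c) xs) ≡ length xs * c
  sum-map-const c []       = refl
  sum-map-const c (x ∷ xs) = cong (c +_) (sum-map-const c xs)

  sum-map-*ʳ : ∀ (f : A → ℕ) c xs → sum (map (λ x → f x * c) xs) ≡ sum (map f xs) * c
  sum-map-*ʳ f c []       = refl
  sum-map-*ʳ f c (x ∷ xs) =
    trans (cong (f x * c +_) (sum-map-*ʳ f c xs)) (sym (ℕ.*-distribʳ-+ c (f x) (sum (map f xs))))

-- Counting maps Fin m → Fin k

allFuns-unique : ∀ m k → AllPairs (λ f g → ¬ f ≗ g) (allFuns m k)
allFuns-unique zero    k = [] ∷ []
allFuns-unique (suc m) k =
  AllPairs.concat⁺ (All.map⁺ (All.universal (λ i → AllPairs.map⁺ (tail-distinct i)) (allFin k)))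
    (AllPairs.map⁺ (AllPairs.tabulate⁺ λ i≢j →
      All.map⁺ (All.universal (λ f → All.map⁺ (All.universal (λ g f≗g → i≢j (f≗g zero)) _)) _)))
  where
  tail-distinct : ∀ i → AllPairs _ (allFuns m k)
  tail-distinct i = AllPairs.map (λ f≉g f≗g → f≉g (f≗g ∘ suc)) (allFuns-unique m k)

allFuns-complete : ∀ m k (f : Fin m → Fin k) → Any (f ≗_) (allFuns m k)
allFuns-complete zero    k f = here (λ ())
allFuns-complete (suc m) k f =
  Any.concat⁺ (Any.map⁺ (Any.map (λ { refl → Any.map⁺ (Any.map (λ f∘suc≗g → λ { zero → refl ; (suc x) → f∘suc≗g x })
                                                          (allFuns-complete m k (f ∘ suc))) })
                                 (∈-allFin (f zero))))

-- Opaque, so that the implicit arguments of count are inferred from the predicate.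
opaque
  count : {P : Pred (Fin m → Fin k) 0ℓ} → Decidable P → ℕ
  count {m} {k} P? = length (filter P? (allFuns m k))

  count-mono : {P Q : Pred (Fin m → Fin k) 0ℓ} (P? : Decidable P) (Q? : Decidable Q) →
               P ⊆ Q → count P? ≤ count Q?
  count-mono {m} {k} P? Q? P⊆Q = length-filter-mono P? Q? P⊆Q (allFuns m k)

  count-cong : {P Q : Pred (Fin m → Fin k) 0ℓ} (P? : Decidable P) (Q? : Decidable Q) →
               P ≐ Q → count P? ≡ count Q?
  count-cong {m} {k} P? Q? P≐Q = cong length (filter-≐ P? Q? P≐Q (allFuns m k))

  count-split : {P Q : Pred (Fin m → Fin k) 0ℓ} (P? : Decidable P) (Q? : Decidable Q) →
                count P? ≡ count (P? ∩? Q?) + count (P? ∩? ∁? Q?)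
  count-split {m} {k} P? Q? = length-filter-split P? Q? (allFuns m k)

  count-all : {P : Pred (Fin m → Fin k) 0ℓ} (P? : Decidable P) → (∀ f → P f) → count P? ≡ length (allFuns m k)
  count-all {m} {k} P? all-P = cong length (filter-all P? (All.universal all-P (allFuns m k)))

  count-none : {P : Pred (Fin m → Fin k) 0ℓ} (P? : Decidable P) → (∀ f → ¬ P f) → count P? ≡ 0
  count-none {m} {k} P? no-P = cong length (filter-none P? (All.universal no-P (allFuns m k)))

  count-witness : {P : Pred (Fin m → Fin k) 0ℓ} (P? : Decidable P) → count P? ≢ 0 → Σ (Fin m → Fin k) P
  count-witness {m} {k} P? count≢0 with filter P? (allFuns m k) | All.all-filter P? (allFuns m k)
  ... | []    | _        = contradiction refl count≢0
  ... | f ∷ _ | Pf ∷ _   = f , Pf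

  e≡count : (P : StrictPoset m) → e P ≡ count (isLinearExtension? P)
  e≡count P = refl

  -- Without function extensionality, maps are only distinct up to _≗_, whence the setoid pigeonhole.
  count-≤-injection : {P : Pred (Fin m → Fin k) 0ℓ} {Q : Pred (Fin m′ → Fin k′) 0ℓ}
                      (P? : Decidable P) (Q? : Decidable Q) → Q Respects _≗_ →
                      (Φ : ∀ f → P f → (Fin m′ → Fin k′)) → (∀ f p → Q (Φ f p)) →
                      (∀ f g p q → Φ f p ≗ Φ g q → f ≗ g) → count P? ≤ count Q?
  count-≤-injection {m} {k} {m′} {k′} {P} P? Q? Q-resp Φ Φ∈Q Φ-inj = begin
    count P?          ≡⟨ sym (length-reduce (λ {f} → Φ f) Ps) ⟩
    length image      ≤⟨ unique-length-≤ (Fin m′ →-setoid Fin k′) image-unique image⊆Q ⟩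
    count Q?          ∎
    where
    open ℕ.≤-Reasoning
    Ps : All P (filter P? (allFuns m k))
    Ps = All.all-filter P? (allFuns m k)
    image : List (Fin m′ → Fin k′)
    image = All.reduce (λ {f} → Φ f) Ps
    image-unique : AllPairs (λ f g → ¬ f ≗ g) image
    image-unique = allPairs-reduce (λ {f} → Φ f) (λ p q f≉g Φf≗Φg → f≉g (Φ-inj _ _ p q Φf≗Φg)) Ps
                     (AllPairs.filter⁺ P? (allFuns-unique m k))
    image⊆Q : All (λ g → Any (g ≗_) (filter Q? (allFuns m′ k′))) image
    image⊆Q = all-reduce (λ {f} → Φ f)
                (λ {f} p _ → ∈-filter⁺ (Fin m′ →-setoid Fin k′) Q? Q-resp (allFuns-complete m′ k′ (Φ f p)) (Φ∈Q f p))
                Ps Ps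

  count-suc : {P : Pred (Fin (suc m) → Fin k) 0ℓ} (P? : Decidable P) → P Respects _≗_ →
              count P? ≡ sum (map (λ i → count (λ f → P? (i Vector.∷ f))) (allFin k))
  -- allFuns builds its elements with an extended lambda that cannot be named here,
  -- so it is abstracted as cons and found by unification.
  count-suc {m} {k} P? P-resp = by-blocks _ (λ i f → λ { zero → refl ; (suc x) → refl })
    where
    open ≡-Reasoning
    by-blocks : (cons : Fin k → (Fin m → Fin k) → (Fin (suc m) → Fin k)) → (∀ i f → cons i f ≗ i Vector.∷ f) →
                length (filter P? (concat (map (λ i → map (cons i) (allFuns m k)) (allFin k))))
                  ≡ sum (map (λ i → count (λ f → P? (i Vector.∷ f))) (allFin k))
    by-blocks cons cons≗ = begin
      length (filter P? (concat (map block (allFin k))))       ≡⟨ length-filter-concat P? (map block (allFin k)) ⟩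
      sum (map (length ∘ filter P?) (map block (allFin k)))    ≡⟨ cong sum (sym (map-∘ (allFin k))) ⟩
      sum (map (length ∘ filter P? ∘ block) (allFin k))        ≡⟨ cong sum (map-cong block-count (allFin k)) ⟩
      sum (map (λ i → count (λ f → P? (i Vector.∷ f))) (allFin k)) ∎
      where
      block : Fin k → List (Fin (suc m) → Fin k)
      block i = map (cons i) (allFuns m k)
      block-count : ∀ i → length (filter P? (block i)) ≡ count (λ f → P? (i Vector.∷ f))
      block-count i = trans (length-filter-map P? (cons i) (allFuns m k))
        (count-cong (P? ∘ cons i) (λ f → P? (i Vector.∷ f)) (P-resp (cons≗ i _) , P-resp (sym ∘ cons≗ i _)))

module _ {P S : Pred (Fin m → Fin k) 0ℓ} (P? : Decidable P) (S? : Decidable S)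
         (P-resp : P Respects _≗_) (S-resp : S Respects _≗_) where

  count-halves : (σ : (Fin m → Fin k) → (Fin m → Fin k)) → (∀ f g → σ f ≗ σ g → f ≗ g) →
                 (∀ {f} → (P ∩ S) f → (P ∩ ∁ S) (σ f)) → (∀ {f} → (P ∩ ∁ S) f → (P ∩ S) (σ f)) →
                 count P? ≡ count (P? ∩? S?) * 2
  count-halves σ σ-inj σ-S→∁S σ-∁S→S = begin
    count P?                                    ≡⟨ count-split P? S? ⟩
    count (P? ∩? S?) + count (P? ∩? ∁? S?)      ≡⟨ cong (count (P? ∩? S?) +_) (sym balanced) ⟩
    count (P? ∩? S?) + count (P? ∩? S?)         ≡⟨ cong (count (P? ∩? S?) +_) (sym (ℕ.+-identityʳ _)) ⟩
    2 * count (P? ∩? S?)                        ≡⟨ ℕ.*-comm 2 (count (P? ∩? S?)) ⟩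
    count (P? ∩? S?) * 2                        ∎
    where
    open ≡-Reasoning
    ∁S-resp : ∁ S Respects _≗_
    ∁S-resp f≗g ¬Sf Sg = ¬Sf (S-resp (sym ∘ f≗g) Sg)
    balanced : count (P? ∩? S?) ≡ count (P? ∩? ∁? S?)
    balanced = ℕ.≤-antisym
      (count-≤-injection (P? ∩? S?) (P? ∩? ∁? S?) (λ f≗g (p , ¬s) → P-resp f≗g p , ∁S-resp f≗g ¬s)
        (λ f _ → σ f) (λ _ → σ-S→∁S) (λ f g _ _ → σ-inj f g))
      (count-≤-injection (P? ∩? ∁? S?) (P? ∩? S?) (λ f≗g (p , s) → P-resp f≗g p , S-resp f≗g s)
        (λ f _ → σ f) (λ _ → σ-∁S→S) (λ f g _ _ → σ-inj f g))

IsInjective : Pred (Fin m → Fin k) 0ℓ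
IsInjective f = ∀ x y → f x ≡ f y → x ≡ y

injective? : Decidable (IsInjective {m} {k})
injective? f = all? λ x → all? λ y → (f x ≟ f y) →-dec (x ≟ y)

injective-resp : IsInjective {m} {k} Respects _≗_
injective-resp f≗g f-inj x y gx≡gy = f-inj x y (trans (f≗g x) (trans gx≡gy (sym (f≗g y))))

Avoids : Fin k → Pred (Fin m → Fin k) 0ℓ
Avoids i f = ∀ x → f x ≢ i

avoids? : (i : Fin k) → Decidable (Avoids {k} {m} i)
avoids? i f = all? λ x → ¬? (f x ≟ i)

injective-∷ : ∀ (i : Fin k) → (λ f → IsInjective {suc m} (i Vector.∷ f)) ≐ (IsInjective ∩ Avoids i)
injective-∷ i = restrict , extend
  where
  restrict : ∀ {f} → IsInjective (i Vector.∷ f) → (IsInjective ∩ Avoids i) f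
  restrict inj = (λ x y fx≡fy → suc-injective (inj (suc x) (suc y) fx≡fy))
               , (λ x fx≡i → 0≢1+n (inj zero (suc x) (sym fx≡i)))
  extend : ∀ {f} → (IsInjective ∩ Avoids i) f → IsInjective (i Vector.∷ f)
  extend (inj , avoid) zero    zero    _     = refl
  extend (inj , avoid) zero    (suc y) i≡fy  = contradiction (sym i≡fy) (avoid y)
  extend (inj , avoid) (suc x) zero    fx≡i  = contradiction fx≡i (avoid x)
  extend (inj , avoid) (suc x) (suc y) fx≡fy = cong suc (inj x y fx≡fy)

count-injective-avoiding : ∀ {m k} (i : Fin (suc k)) →
                           count (injective? {m} ∩? avoids? i) ≡ count (injective? {m} {k})
count-injective-avoiding {m} {k} i = ℕ.≤-antisym
  (count-≤-injection (injective? ∩? avoids? i) (injective? {m} {k}) injective-resp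
    (λ f (_ , avoid) x → punchOut (avoid x ∘ sym))
    (λ f (inj , avoid) x y eq → inj x y (punchOut-injective (avoid x ∘ sym) (avoid y ∘ sym) eq))
    (λ f g (_ , avoid-f) (_ , avoid-g) eq x → punchOut-injective (avoid-f x ∘ sym) (avoid-g x ∘ sym) (eq x)))
  (count-≤-injection (injective? {m} {k}) (injective? ∩? avoids? i)
    (λ f≗g (inj , avoid) → injective-resp f≗g inj , λ x gx≡i → avoid x (trans (f≗g x) gx≡i))
    (λ f _ → punchIn i ∘ f)
    (λ f inj → (λ x y eq → inj x y (punchIn-injective i _ _ eq)) , λ x → punchInᵢ≢i i (f x))
    (λ f g _ _ eq x → punchIn-injective i _ _ (eq x)))

fallingFactorial : ℕ → ℕ → ℕ
fallingFactorial k       zero    = 1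
fallingFactorial zero    (suc m) = 0
fallingFactorial (suc k) (suc m) = suc k * fallingFactorial k m

fallingFactorial-diagonal : ∀ n → fallingFactorial n n ≡ n !
fallingFactorial-diagonal zero    = refl
fallingFactorial-diagonal (suc n) = cong (suc n *_) (fallingFactorial-diagonal n)

double-factorial : ∀ n → (2 * n) ! ≡ n ! * oddDoubleFact n * 2 ^ n
double-factorial zero    = refl
double-factorial (suc n) = begin
  (2 * suc n) !
    ≡⟨ cong _! (ℕ.*-suc 2 n) ⟩
  (2 + 2 * n) * ((1 + 2 * n) * (2 * n) !)
    ≡⟨ cong (λ x → (2 + 2 * n) * ((1 + 2 * n) * x)) (double-factorial n) ⟩
  (2 + 2 * n) * ((1 + 2 * n) * (n ! * oddDoubleFact n * 2 ^ n))
    ≡⟨ rearrange n (n !) (oddDoubleFact n) (2 ^ n) ⟩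
  suc n ! * oddDoubleFact (suc n) * 2 ^ suc n
    ∎
  where
  open ≡-Reasoning
  rearrange : ∀ n f d t → (2 + 2 * n) * ((1 + 2 * n) * (f * d * t)) ≡ (1 + n) * f * ((2 * n + 1) * d) * (2 * t)
  rearrange = solve 4 (λ n f d t → (con 2 :+ con 2 :* n) :* ((con 1 :+ con 2 :* n) :* (f :* d :* t))
                                := (con 1 :+ n) :* f :* ((con 2 :* n :+ con 1) :* d) :* (con 2 :* t)) refl

count-injective : ∀ m k → count (injective? {m} {k}) ≡ fallingFactorial k m
count-injective zero    k       = count-all (injective? {0} {k}) (λ f ())
count-injective (suc m) zero    = count-none injective? (λ f _ → ¬Fin0 (f zero))
count-injective (suc m) (suc k) = begin
  count (injective? {suc m} {suc k})
    ≡⟨ count-suc injective? injective-resp ⟩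
  sum (map (λ i → count (λ f → injective? (i Vector.∷ f))) (allFin (suc k)))
    ≡⟨ cong sum (map-cong first-fixed (allFin (suc k))) ⟩
  sum (map (λ _ → count (injective? {m} {k})) (allFin (suc k)))
    ≡⟨ sum-map-const _ (allFin (suc k)) ⟩
  length (allFin (suc k)) * count (injective? {m} {k})
    ≡⟨ cong₂ _*_ (length-tabulate {n = suc k} id) (count-injective m k) ⟩
  suc k * fallingFactorial k m
    ∎
  where
  open ≡-Reasoning
  first-fixed : ∀ i → count (λ f → injective? (i Vector.∷ f)) ≡ count (injective? {m} {k})
  first-fixed i = trans (count-cong _ (injective? ∩? avoids? i) (injective-∷ i)) (count-injective-avoiding i)

count-permutations : ∀ n → count (injective? {n} {n}) ≡ n !
count-permutations n = trans (count-injective n n) (fallingFactorial-diagonal n)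

-- A missed value y could be punched out, injecting Fin (suc m) into Fin m.
injective⇒surjective : (f : Fin m → Fin m) → IsInjective f → ∀ y → Σ (Fin m) λ x → f x ≡ y
injective⇒surjective {suc m} f inj y with any? (λ x → f x ≟ y)
... | yes found  = found
... | no missing =
  let i , j , i<j , eq = pigeonhole (ℕ.n<1+n m) (λ x → punchOut {i = y} (missing ∘ (x ,_) ∘ sym))
  in contradiction (inj i j (punchOut-injective (missing ∘ (i ,_) ∘ sym) (missing ∘ (j ,_) ∘ sym) eq)) (<⇒≢ i<j)

count-take×drop : ∀ m₁ {m₂} {P₁ : Pred (Fin m₁ → Fin k) 0ℓ} {P₂ : Pred (Fin m₂ → Fin k) 0ℓ}
                  (P₁? : Decidable P₁) (P₂? : Decidable P₂) → P₁ Respects _≗_ → P₂ Respects _≗_ →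
                  count (λ h → P₁? (Vector.take m₁ h) ×-dec P₂? (Vector.drop m₁ h)) ≡ count P₁? * count P₂?
-- Up to _≗_, (λ ()) is the only map out of Fin 0, so P₁ holds everywhere or nowhere.
count-take×drop zero P₁? P₂? P₁-resp P₂-resp with P₁? (λ ())
... | yes p₁ = begin
  count (λ h → P₁? (Vector.take 0 h) ×-dec P₂? h)
    ≡⟨ count-cong _ P₂? (proj₂ , λ p₂ → P₁-resp (λ ()) p₁ , p₂) ⟩
  count P₂?
    ≡⟨ sym (ℕ.+-identityʳ _) ⟩
  1 * count P₂?
    ≡⟨ cong (_* count P₂?) (sym (count-all P₁? (λ f → P₁-resp (λ ()) p₁))) ⟩
  count P₁? * count P₂?
    ∎
  where open ≡-Reasoning
... | no ¬p₁ = trans (count-none _ λ h (p₁ , _) → ¬p₁ (P₁-resp (λ ()) p₁))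
                     (cong (_* count P₂?) (sym (count-none P₁? λ f p₁ → ¬p₁ (P₁-resp (λ ()) p₁))))
count-take×drop {k} (suc m₁) {m₂} {P₁} {P₂} P₁? P₂? P₁-resp P₂-resp = begin
  count Q?
    ≡⟨ count-suc Q? Q-resp ⟩
  sum (map (λ i → count (λ h → Q? (i Vector.∷ h))) (allFin k))
    ≡⟨ cong sum (map-cong split-head (allFin k)) ⟩
  sum (map (λ i → count (head i) * count P₂?) (allFin k))
    ≡⟨ sum-map-*ʳ (count ∘ head) (count P₂?) (allFin k) ⟩
  sum (map (λ i → count (head i)) (allFin k)) * count P₂?
    ≡⟨ cong (_* count P₂?) (sym (count-suc P₁? P₁-resp)) ⟩
  count P₁? * count P₂?
    ∎
  where
  open ≡-Reasoning
  Q? : Decidable (λ h → P₁ (Vector.take (suc m₁) h) × P₂ (Vector.drop (suc m₁) {m₂} h))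
  Q? h = P₁? (Vector.take (suc m₁) h) ×-dec P₂? (Vector.drop (suc m₁) h)
  Q-resp : (λ h → P₁ (Vector.take (suc m₁) h) × P₂ (Vector.drop (suc m₁) {m₂} h)) Respects _≗_
  Q-resp h≗h′ (p₁ , p₂) = P₁-resp (h≗h′ ∘ (_↑ˡ m₂)) p₁ , P₂-resp (h≗h′ ∘ (suc m₁ ↑ʳ_)) p₂
  head : (i : Fin k) → Decidable (λ (g : Fin m₁ → Fin k) → P₁ (i Vector.∷ g))
  head i g = P₁? (i Vector.∷ g)
  take-∷ : ∀ i (h : Fin (m₁ + m₂) → Fin k) → Vector.take (suc m₁) (i Vector.∷ h) ≗ i Vector.∷ Vector.take m₁ h
  take-∷ i h zero    = refl
  take-∷ i h (suc x) = refl
  split-head : ∀ i → count (λ h → Q? (i Vector.∷ h)) ≡ count (head i) * count P₂?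
  split-head i = trans
    (count-cong (λ h → Q? (i Vector.∷ h)) (λ h → head i (Vector.take m₁ h) ×-dec P₂? (Vector.drop m₁ h))
      ((λ (p₁ , p₂) → P₁-resp (take-∷ i _) p₁ , p₂) , λ (p₁ , p₂) → P₁-resp (sym ∘ take-∷ i _) p₁ , p₂))
    (count-take×drop m₁ (head i) P₂? (λ g≗g′ → P₁-resp λ { zero → refl ; (suc x) → g≗g′ x }) P₂-resp)

module _ {m} (p q : Fin m) where

  transpose-matchˡ : transpose p q p ≡ q
  transpose-matchˡ with p ≟ p
  ... | yes _  = refl
  ... | no p≢p = contradiction refl p≢p

  transpose-matchʳ : transpose p q q ≡ p
  transpose-matchʳ with q ≟ p
  ... | yes q≡p = q≡p
  ... | no _ with q ≟ q
  ...   | yes _  = refl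
  ...   | no q≢q = contradiction refl q≢q

  transpose-other : ∀ {z} → z ≢ p → z ≢ q → transpose p q z ≡ z
  transpose-other {z} z≢p z≢q with z ≟ p
  ... | yes z≡p = contradiction z≡p z≢p
  ... | no _ with z ≟ q
  ...   | yes z≡q = contradiction z≡q z≢q
  ...   | no _    = refl

  transpose-involutive : ∀ z → transpose p q (transpose p q z) ≡ z
  transpose-involutive z = by-cases (z ≟ p) (z ≟ q)
    where
    by-cases : Dec (z ≡ p) → Dec (z ≡ q) → transpose p q (transpose p q z) ≡ z
    by-cases (yes refl) _          = trans (cong (transpose p q) transpose-matchˡ) transpose-matchʳ
    by-cases (no _)     (yes refl) = trans (cong (transpose p q) transpose-matchʳ) transpose-matchˡ
    by-cases (no z≢p)   (no z≢q)   =
      trans (cong (transpose p q) (transpose-other z≢p z≢q)) (transpose-other z≢p z≢q)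

  transpose-injective : ∀ {x y} → transpose p q x ≡ transpose p q y → x ≡ y
  transpose-injective {x} {y} eq =
    trans (sym (transpose-involutive x)) (trans (cong (transpose p q) eq) (transpose-involutive y))

  module _ (adjacent : toℕ q ≡ suc (toℕ p)) where

    p<q : p Fin.< q
    p<q = ℕ.≤-reflexive (sym adjacent)

    transpose-adjacent-≤ : ∀ {z} → z ≢ p → transpose p q z Fin.≤ z
    transpose-adjacent-≤ {z} z≢p = by-cases (z ≟ q)
      where
      by-cases : Dec (z ≡ q) → transpose p q z Fin.≤ z
      by-cases (yes refl) = subst (Fin._≤ q) (sym transpose-matchʳ) (ℕ.<⇒≤ p<q)
      by-cases (no z≢q)   = Fin.≤-reflexive (transpose-other z≢p z≢q)

    transpose-adjacent-≥ : ∀ {z} → z ≢ q → z Fin.≤ transpose p q z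
    transpose-adjacent-≥ {z} z≢q = by-cases (z ≟ p)
      where
      by-cases : Dec (z ≡ p) → z Fin.≤ transpose p q z
      by-cases (yes refl) = subst (p Fin.≤_) (sym transpose-matchˡ) (ℕ.<⇒≤ p<q)
      by-cases (no z≢p)   = Fin.≤-reflexive (sym (transpose-other z≢p z≢q))

    transpose-adjacent-< : ∀ {x y} → x Fin.< y → ¬ (x ≡ p × y ≡ q) → transpose p q x Fin.< transpose p q y
    transpose-adjacent-< {x} {y} x<y not-pq = by-cases (x ≟ p) (y ≟ q)
      where
      by-cases : Dec (x ≡ p) → Dec (y ≡ q) → transpose p q x Fin.< transpose p q y
      by-cases (yes refl) (yes refl) = contradiction (refl , refl) not-pq
      by-cases (yes refl) (no y≢q)   =
        subst₂ Fin._<_ (sym transpose-matchˡ) (sym (transpose-other (<⇒≢ x<y ∘ sym) y≢q))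
          (≤∧≢⇒< (subst (_≤ toℕ y) (sym adjacent) x<y) (y≢q ∘ sym))
      by-cases (no x≢p)   (yes refl) =
        subst₂ Fin._<_ (sym (transpose-other x≢p (<⇒≢ x<y))) (sym transpose-matchʳ)
          (≤∧≢⇒< (ℕ.≤-pred (subst (toℕ x <_) adjacent x<y)) x≢p)
      by-cases (no x≢p)   (no y≢q)   =
        ℕ.≤-<-trans (transpose-adjacent-≤ x≢p) (ℕ.<-≤-trans x<y (transpose-adjacent-≥ y≢q))

-- Injections respecting n disjoint pairs

module _ {m n} (a b : Fin n → Fin m) where

  Ordered : List (Fin n) → Pred (Fin m → Fin m) 0ℓ
  Ordered ks ℓ = All (λ i → ℓ (a i) Fin.< ℓ (b i)) ks

  ordered? : ∀ ks → Decidable (Ordered ks)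
  ordered? ks ℓ = All.all? (λ i → ℓ (a i) Fin.<? ℓ (b i)) ks

  ordered-resp : ∀ {ks} → Ordered ks Respects _≗_
  ordered-resp f≗g = All.map (subst₂ Fin._<_ (f≗g _) (f≗g _))

  module _ (a-injective : ∀ {i j} → a i ≡ a j → i ≡ j) (b-injective : ∀ {i j} → b i ≡ b j → i ≡ j)
           (a≢b : ∀ i j → a i ≢ b j) where

    count-injective-ordered-step : ∀ {k ks} → All (k ≢_) ks →
      count (injective? ∩? ordered? ks) ≡ count (injective? ∩? ordered? (k ∷ ks)) * 2
    count-injective-ordered-step {k} {ks} k∉ks = begin
      count (injective? ∩? ordered? ks)                  ≡⟨ halves ⟩
      count ((injective? ∩? ordered? ks) ∩? first?) * 2  ≡⟨ cong (_* 2) (count-cong _ _ (regroup , ungroup)) ⟩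
      count (injective? ∩? ordered? (k ∷ ks)) * 2        ∎
      where
      open ≡-Reasoning
      τ : Fin m → Fin m
      τ = transpose (a k) (b k)

      First : Pred (Fin m → Fin m) 0ℓ
      First ℓ = ℓ (a k) Fin.< ℓ (b k)

      first? : Decidable First
      first? ℓ = ℓ (a k) Fin.<? ℓ (b k)

      swap-injective₂ : ∀ f g → f ∘ τ ≗ g ∘ τ → f ≗ g
      swap-injective₂ f g eq x = trans (cong f (sym (transpose-involutive (a k) (b k) x)))
                                       (trans (eq (τ x)) (cong g (transpose-involutive (a k) (b k) x)))

      swap-injective : ∀ {ℓ} → IsInjective ℓ → IsInjective (ℓ ∘ τ)
      swap-injective inj x y eq = transpose-injective (a k) (b k) (inj _ _ eq)

      swap-ordered : ∀ {ℓ} → Ordered ks ℓ → Ordered ks (ℓ ∘ τ)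
      swap-ordered {ℓ} ord = All.zipWith (λ (k≢i , a<b) →
        subst₂ Fin._<_
          (cong ℓ (sym (transpose-other (a k) (b k) (k≢i ∘ sym ∘ a-injective) (a≢b _ k))))
          (cong ℓ (sym (transpose-other (a k) (b k) (a≢b k _ ∘ sym) (k≢i ∘ sym ∘ b-injective)))) a<b)
        (k∉ks , ord)

      first-swapped : ∀ ℓ → First (ℓ ∘ τ) ≡ (ℓ (b k) Fin.< ℓ (a k))
      first-swapped ℓ = cong₂ Fin._<_ (cong ℓ (transpose-matchˡ (a k) (b k))) (cong ℓ (transpose-matchʳ (a k) (b k)))

      first⇒¬first : ∀ {ℓ} → ((IsInjective ∩ Ordered ks) ∩ First) ℓ → ((IsInjective ∩ Ordered ks) ∩ ∁ First) (ℓ ∘ τ)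
      first⇒¬first {ℓ} ((inj , ord) , a<b) =
        (swap-injective {ℓ} inj , swap-ordered {ℓ} ord) , ℕ.<-asym a<b ∘ subst id (first-swapped ℓ)

      ¬first⇒first : ∀ {ℓ} → ((IsInjective ∩ Ordered ks) ∩ ∁ First) ℓ → ((IsInjective ∩ Ordered ks) ∩ First) (ℓ ∘ τ)
      ¬first⇒first {ℓ} ((inj , ord) , a≮b) =
        (swap-injective {ℓ} inj , swap-ordered {ℓ} ord) ,
        subst id (sym (first-swapped ℓ)) (≤∧≢⇒< (ℕ.≮⇒≥ a≮b) (a≢b k k ∘ inj _ _ ∘ sym))

      regroup : ((IsInjective ∩ Ordered ks) ∩ First) ⊆ (IsInjective ∩ Ordered (k ∷ ks))
      regroup ((inj , ord) , a<b) = inj , a<b ∷ ord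

      ungroup : (IsInjective ∩ Ordered (k ∷ ks)) ⊆ ((IsInjective ∩ Ordered ks) ∩ First)
      ungroup (inj , a<b ∷ ord) = (inj , ord) , a<b

      halves : count (injective? ∩? ordered? ks) ≡ count ((injective? ∩? ordered? ks) ∩? first?) * 2
      halves = count-halves (injective? ∩? ordered? ks) first?
        (λ f≗g (inj , ord) → injective-resp f≗g inj , ordered-resp f≗g ord)
        (λ f≗g → subst₂ Fin._<_ (f≗g (a k)) (f≗g (b k)))
        (_∘ τ) swap-injective₂ first⇒¬first ¬first⇒first

    count-injective-ordered : ∀ ks → Unique ks →
      count (injective? {m} {m}) ≡ count (injective? ∩? ordered? ks) * 2 ^ length ks
    count-injective-ordered []       []            =
      trans (count-cong injective? (injective? ∩? ordered? []) ((_, []) , proj₁)) (sym (ℕ.*-identityʳ _))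
    count-injective-ordered (k ∷ ks) (k∉ks ∷ ks!) = begin
      count injective?
        ≡⟨ count-injective-ordered ks ks! ⟩
      count (injective? ∩? ordered? ks) * 2 ^ length ks
        ≡⟨ cong (_* 2 ^ length ks) (count-injective-ordered-step k∉ks) ⟩
      count (injective? ∩? ordered? (k ∷ ks)) * 2 * 2 ^ length ks
        ≡⟨ ℕ.*-assoc (count (injective? ∩? ordered? (k ∷ ks))) 2 (2 ^ length ks) ⟩
      count (injective? ∩? ordered? (k ∷ ks)) * 2 ^ length (k ∷ ks)
        ∎
      where open ≡-Reasoning

module _ {n : ℕ} where

  slot : Fin n → Fin 2 → Fin (2 * n)
  slot k b = cast (ℕ.*-comm n 2) (combine k b)

  unslot : Fin (2 * n) → Fin n × Fin 2
  unslot p = remQuot 2 (cast (ℕ.*-comm 2 n) p)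

  unslot-slot : ∀ k b → unslot (slot k b) ≡ (k , b)
  unslot-slot k b = trans (cong (remQuot 2) (cast-involutive (ℕ.*-comm 2 n) (ℕ.*-comm n 2) (combine k b)))
                          (remQuot-combine k b)

  slot-unslot : ∀ p → uncurry slot (unslot p) ≡ p
  slot-unslot p = trans (cong (cast (ℕ.*-comm n 2)) (combine-remQuot {n} 2 (cast (ℕ.*-comm 2 n) p)))
                        (cast-involutive (ℕ.*-comm n 2) (ℕ.*-comm 2 n) p)

  slot-injective : ∀ {k k′ b b′} → slot k b ≡ slot k′ b′ → k ≡ k′ × b ≡ b′
  slot-injective {k} {k′} {b} {b′} eq =
    let eq′ = trans (sym (unslot-slot k b)) (trans (cong unslot eq) (unslot-slot k′ b′))
    in ,-injectiveˡ eq′ , ,-injectiveʳ eq′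

  toℕ-slot : ∀ k b → toℕ (slot k b) ≡ 2 * toℕ k + toℕ b
  toℕ-slot k b = trans (toℕ-cast (ℕ.*-comm n 2) (combine k b)) (toℕ-combine k b)

  slot-adjacent : ∀ k → toℕ (slot k 1F) ≡ suc (toℕ (slot k 0F))
  slot-adjacent k = begin
    toℕ (slot k 1F)        ≡⟨ toℕ-slot k 1F ⟩
    2 * toℕ k + 1          ≡⟨ ℕ.+-suc (2 * toℕ k) 0 ⟩
    suc (2 * toℕ k + 0)    ≡⟨ cong suc (sym (toℕ-slot k 0F)) ⟩
    suc (toℕ (slot k 0F))  ∎
    where open ≡-Reasoning

-- Parity of the number of linear extensions

even+-%2 : ∀ {a} b → 2 ∣ a → (a + b) % 2 ≡ b % 2
even+-%2 b (divides c refl) = trans (cong (_% 2) (ℕ.+-comm (c * 2) b)) ([m+kn]%n≡m%n b c 2)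

module _ {m} (P : StrictPoset m) where
  open StrictPoset P using (_≺_; _≺?_)

  linearExtension-resp : IsLinearExtension P Respects _≗_
  linearExtension-resp f≗g (inj , mono) =
    injective-resp f≗g inj , λ x y x≺y → subst₂ Fin._<_ (f≗g x) (f≗g y) (mono x y x≺y)

  UnrelatedAt : Fin m → Fin m → Pred (Fin m → Fin m) 0ℓ
  UnrelatedAt p q ℓ = ∃₂ λ x y → ℓ x ≡ p × ℓ y ≡ q × ¬ x ≺ y

  unrelatedAt? : ∀ p q → Decidable (UnrelatedAt p q)
  unrelatedAt? p q ℓ = any? λ x → any? λ y → ℓ x ≟ p ×-dec ℓ y ≟ q ×-dec ¬? (x ≺? y)

  unrelatedAt-resp : ∀ {p q} → UnrelatedAt p q Respects _≗_
  unrelatedAt-resp f≗g (x , y , fx≡p , fy≡q , x⊀y) =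
    x , y , trans (sym (f≗g x)) fx≡p , trans (sym (f≗g y)) fy≡q , x⊀y

  unrelatedAt-transpose : ∀ {p q p′ q′ ℓ} → p′ ≢ p → p′ ≢ q → q′ ≢ p → q′ ≢ q →
                          UnrelatedAt p′ q′ (transpose p q ∘ ℓ) → UnrelatedAt p′ q′ ℓ
  unrelatedAt-transpose {p} {q} p′≢p p′≢q q′≢p q′≢q (x , y , σℓx≡p′ , σℓy≡q′ , x⊀y) =
    x , y , fixed σℓx≡p′ (transpose-other p q p′≢p p′≢q) , fixed σℓy≡q′ (transpose-other p q q′≢p q′≢q) , x⊀y
    where
    fixed : ∀ {z w} → transpose p q z ≡ w → transpose p q w ≡ w → z ≡ w
    fixed σz≡w σw≡w = transpose-injective p q (trans σz≡w (sym σw≡w))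

  module _ {p q : Fin m} (adjacent : toℕ q ≡ suc (toℕ p)) where

    transpose-linearExtension : ∀ {ℓ} → IsLinearExtension P ℓ → UnrelatedAt p q ℓ →
                                IsLinearExtension P (transpose p q ∘ ℓ)
    transpose-linearExtension {ℓ} (inj , mono) (x , y , ℓx≡p , ℓy≡q , x⊀y) =
      (λ u v eq → inj u v (transpose-injective p q eq)) ,
      λ u v u≺v → transpose-adjacent-< p q adjacent (mono u v u≺v) λ (ℓu≡p , ℓv≡q) →
        x⊀y (subst₂ _≺_ (inj u x (trans ℓu≡p (sym ℓx≡p))) (inj v y (trans ℓv≡q (sym ℓy≡q))) u≺v)

    transpose-unrelatedAt : ∀ {ℓ x y} → IsLinearExtension P ℓ → ℓ x ≡ p → ℓ y ≡ q → ¬ x ≺ y →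
                            transpose p q (ℓ y) ≡ p × transpose p q (ℓ x) ≡ q × ¬ y ≺ x
    transpose-unrelatedAt {ℓ} {x} {y} (_ , mono) ℓx≡p ℓy≡q _ =
      trans (cong (transpose p q) ℓy≡q) (transpose-matchʳ p q) ,
      trans (cong (transpose p q) ℓx≡p) (transpose-matchˡ p q) ,
      λ y≺x → ℕ.<-asym (mono y x y≺x) (subst₂ Fin._<_ (sym ℓx≡p) (sym ℓy≡q) (p<q p q adjacent))

    count-unrelatedAt-even : {E : Pred (Fin m → Fin m) 0ℓ} (E? : Decidable E) → E Respects _≗_ →
      (∀ {ℓ} → IsLinearExtension P ℓ → UnrelatedAt p q ℓ → E ℓ → E (transpose p q ∘ ℓ)) →
      2 ∣ count ((isLinearExtension? P ∩? E?) ∩? unrelatedAt? p q)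
    count-unrelatedAt-even {E} E? E-resp E-transpose = divides (count (class? ∩? ascending?))
      (count-halves class? ascending? class-resp ascending-resp
        (transpose p q ∘_) (λ f g eq x → transpose-injective p q (eq x)) ascending⇒descending descending⇒ascending)
      where
      Class : Pred (Fin m → Fin m) 0ℓ
      Class = (IsLinearExtension P ∩ E) ∩ UnrelatedAt p q

      class? : Decidable Class
      class? = (isLinearExtension? P ∩? E?) ∩? unrelatedAt? p q

      class-resp : Class Respects _≗_
      class-resp f≗g ((le , e) , u) = (linearExtension-resp f≗g le , E-resp f≗g e) , unrelatedAt-resp f≗g u

      swap : ∀ {ℓ} → Class ℓ → Class (transpose p q ∘ ℓ)
      swap ((le , e) , u@(x , y , ℓx≡p , ℓy≡q , x⊀y)) =
        (transpose-linearExtension le u , E-transpose le u e) , y , x , transpose-unrelatedAt le ℓx≡p ℓy≡q x⊀y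

      -- Splitting by this orientation of the unrelated pair, swap maps each half into the other.
      Ascending : Pred (Fin m → Fin m) 0ℓ
      Ascending ℓ = ∀ x y → ℓ x ≡ p → ℓ y ≡ q → x Fin.< y

      ascending? : Decidable Ascending
      ascending? ℓ = all? λ x → all? λ y → ℓ x ≟ p →-dec ℓ y ≟ q →-dec x Fin.<? y

      ascending-resp : Ascending Respects _≗_
      ascending-resp f≗g asc x y gx≡p gy≡q = asc x y (trans (f≗g x) gx≡p) (trans (f≗g y) gy≡q)

      ascending-intro : ∀ {ℓ x y} → IsInjective ℓ → ℓ x ≡ p → ℓ y ≡ q → x Fin.< y → Ascending ℓ
      ascending-intro {ℓ} {x} {y} inj ℓx≡p ℓy≡q x<y x′ y′ ℓx′≡p ℓy′≡q =
        subst₂ Fin._<_ (inj x x′ (trans ℓx≡p (sym ℓx′≡p))) (inj y y′ (trans ℓy≡q (sym ℓy′≡q))) x<y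

      ascending⇒descending : ∀ {ℓ} → (Class ∩ Ascending) ℓ → (Class ∩ ∁ Ascending) (transpose p q ∘ ℓ)
      ascending⇒descending (class@((le , _) , x , y , ℓx≡p , ℓy≡q , x⊀y) , asc) =
        let σℓy≡p , σℓx≡q , _ = transpose-unrelatedAt le ℓx≡p ℓy≡q x⊀y
        in swap class , λ asc′ → ℕ.<-asym (asc x y ℓx≡p ℓy≡q) (asc′ y x σℓy≡p σℓx≡q)

      descending⇒ascending : ∀ {ℓ} → (Class ∩ ∁ Ascending) ℓ → (Class ∩ Ascending) (transpose p q ∘ ℓ)
      descending⇒ascending (class@((le@(inj , _) , _) , u@(x , y , ℓx≡p , ℓy≡q , x⊀y)) , ¬asc) =
        let σℓy≡p , σℓx≡q , _ = transpose-unrelatedAt le ℓx≡p ℓy≡q x⊀y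
            y≢x : y ≢ x
            y≢x y≡x = ℕ.1+n≢n (trans (sym adjacent) (cong toℕ (trans (sym ℓy≡q) (trans (cong _ y≡x) ℓx≡p))))
            y<x = ≤∧≢⇒< (ℕ.≮⇒≥ (¬asc ∘ ascending-intro inj ℓx≡p ℓy≡q)) y≢x
        in swap class , ascending-intro (proj₁ (transpose-linearExtension le u)) σℓy≡p σℓx≡q y<x

    count-linearExtensions-mod-2 : {E : Pred (Fin m → Fin m) 0ℓ} (E? : Decidable E) → E Respects _≗_ →
      (∀ {ℓ} → IsLinearExtension P ℓ → UnrelatedAt p q ℓ → E ℓ → E (transpose p q ∘ ℓ)) →
      count (isLinearExtension? P ∩? E?) % 2 ≡ count ((isLinearExtension? P ∩? E?) ∩? ∁? (unrelatedAt? p q)) % 2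
    count-linearExtensions-mod-2 {E} E? E-resp E-transpose = begin
      count L? % 2                                      ≡⟨ cong (_% 2) (count-split L? U?) ⟩
      (count (L? ∩? U?) + count (L? ∩? ∁? U?)) % 2      ≡⟨ even+-%2 _ (count-unrelatedAt-even E? E-resp E-transpose) ⟩
      count (L? ∩? ∁? U?) % 2                           ∎
      where
      open ≡-Reasoning
      L? : Decidable (IsLinearExtension P ∩ E)
      L? = isLinearExtension? P ∩? E?
      U? : Decidable (UnrelatedAt p q)
      U? = unrelatedAt? p q

module _ {n} (P : StrictPoset (2 * n)) where

  Matched : List (Fin n) → Pred (Fin (2 * n) → Fin (2 * n)) 0ℓ
  Matched ks ℓ = All (λ k → ¬ UnrelatedAt P (slot k 0F) (slot k 1F) ℓ) ks

  matched? : ∀ ks → Decidable (Matched ks)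
  matched? ks ℓ = All.all? (λ k → ¬? (unrelatedAt? P (slot k 0F) (slot k 1F) ℓ)) ks

  matched-resp : ∀ {ks} → Matched ks Respects _≗_
  matched-resp f≗g = All.map (λ ¬u u → ¬u (unrelatedAt-resp P (sym ∘ f≗g) u))

  matched-transpose : ∀ {k ks ℓ} → UnrelatedAt P (slot k 0F) (slot k 1F) ℓ → Matched ks ℓ →
                      Matched ks (transpose (slot k 0F) (slot k 1F) ∘ ℓ)
  matched-transpose {k} u = All.map λ {k′} ¬u′ →
    let k′≢k : k′ ≢ k
        k′≢k k′≡k = ¬u′ (subst (λ j → UnrelatedAt P (slot j 0F) (slot j 1F) _) (sym k′≡k) u)
        apart : ∀ {b b′} → slot k′ b ≢ slot k b′
        apart = k′≢k ∘ proj₁ ∘ slot-injective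
    in ¬u′ ∘ unrelatedAt-transpose P apart apart apart apart

  count-matched-mod-2 : ∀ ks → count (isLinearExtension? P ∩? matched? ks) % 2 ≡ e P % 2
  count-matched-mod-2 []       =
    cong (_% 2) (trans (count-cong (isLinearExtension? P ∩? matched? []) (isLinearExtension? P) (proj₁ , (_, [])))
                       (sym (e≡count P)))
  count-matched-mod-2 (k ∷ ks) = begin
    count (isLinearExtension? P ∩? matched? (k ∷ ks)) % 2
      ≡⟨ cong (_% 2) (count-cong (isLinearExtension? P ∩? matched? (k ∷ ks)) (L? ∩? ∁? (unrelatedAt? P _ _))
                        ((λ { (le , ¬u ∷ m) → (le , m) , ¬u }) , (λ ((le , m) , ¬u) → le , ¬u ∷ m))) ⟩
    count (L? ∩? ∁? (unrelatedAt? P _ _)) % 2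
      ≡⟨ sym (count-linearExtensions-mod-2 P (slot-adjacent k) (matched? ks) matched-resp (λ _ → matched-transpose)) ⟩
    count L? % 2
      ≡⟨ count-matched-mod-2 ks ⟩
    e P % 2 ∎
    where
    open ≡-Reasoning
    L? : Decidable (IsLinearExtension P ∩ Matched ks)
    L? = isLinearExtension? P ∩? matched? ks

  odd⇒matchedExtension : e P % 2 ≡ 1 → Σ (Fin (2 * n) → Fin (2 * n)) (IsLinearExtension P ∩ Matched (allFin n))
  odd⇒matchedExtension odd = count-witness (isLinearExtension? P ∩? matched? (allFin n)) λ count≡0 →
    ℕ.0≢1+n (trans (cong (_% 2) (sym count≡0)) (trans (count-matched-mod-2 (allFin n)) odd))

-- A linear extension matched at every pair

module MatchedExtension {n} (P : StrictPoset (2 * n)) (height≤2 : HasHeight≤2 P)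
                        {ℓ₀} (ℓ₀-linear : IsLinearExtension P ℓ₀) (ℓ₀-matched : Matched P (allFin n) ℓ₀) where
  open StrictPoset P using (_≺_; _≺?_)

  ℓ₀-injective : IsInjective ℓ₀
  ℓ₀-injective = proj₁ ℓ₀-linear

  elementAt : Fin (2 * n) → Fin (2 * n)
  elementAt p = proj₁ (injective⇒surjective ℓ₀ ℓ₀-injective p)

  ℓ₀-elementAt : ∀ p → ℓ₀ (elementAt p) ≡ p
  ℓ₀-elementAt p = proj₂ (injective⇒surjective ℓ₀ ℓ₀-injective p)

  elementAt-injective : ∀ {p p′} → elementAt p ≡ elementAt p′ → p ≡ p′
  elementAt-injective {p} {p′} eq = trans (sym (ℓ₀-elementAt p)) (trans (cong ℓ₀ eq) (ℓ₀-elementAt p′))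

  slotOf : Fin (2 * n) → Fin n × Fin 2
  slotOf u = unslot {n} (ℓ₀ u)

  slotOf-injective : ∀ {x y} → slotOf x ≡ slotOf y → x ≡ y
  slotOf-injective {x} {y} eq = ℓ₀-injective x y
    (trans (sym (slot-unslot {n} (ℓ₀ x))) (trans (cong (uncurry slot) eq) (slot-unslot {n} (ℓ₀ y))))

  slotOf-elementAt : ∀ k b → slotOf (elementAt (slot k b)) ≡ (k , b)
  slotOf-elementAt k b = trans (cong unslot (ℓ₀-elementAt (slot k b))) (unslot-slot k b)

  elementAt-slotOf : ∀ {u k b} → slotOf u ≡ (k , b) → u ≡ elementAt (slot k b)
  elementAt-slotOf {u} {k} {b} eq = slotOf-injective (trans eq (sym (slotOf-elementAt k b)))

  bottom top : Fin n → Fin (2 * n)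
  bottom k = elementAt (slot k 0F)
  top    k = elementAt (slot k 1F)

  bottom-injective : ∀ {k k′} → bottom k ≡ bottom k′ → k ≡ k′
  bottom-injective = proj₁ ∘ slot-injective ∘ elementAt-injective

  top-injective : ∀ {k k′} → top k ≡ top k′ → k ≡ k′
  top-injective = proj₁ ∘ slot-injective ∘ elementAt-injective

  bottom≢top : ∀ k k′ → bottom k ≢ top k′
  bottom≢top k k′ eq with () ← proj₂ (slot-injective {k = k} {k′} (elementAt-injective eq))

  bottom≺top : ∀ k → bottom k ≺ top k
  bottom≺top k with bottom k ≺? top k
  ... | yes b≺t = b≺t
  ... | no b⊀t = contradiction (bottom k , top k , ℓ₀-elementAt _ , ℓ₀-elementAt _ , b⊀t)
                               (All.lookup ℓ₀-matched (∈-allFin k))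

  -- An element at an odd position lies above its partner and an element at an even position below it,
  -- so by height 2 every relation goes from an even position to an odd one.
  related-slots : ∀ {u v} → u ≺ v →
                  Σ (Fin n) (λ k → slotOf u ≡ (k , 0F)) × Σ (Fin n) (λ k → slotOf v ≡ (k , 1F))
  related-slots {u} {v} u≺v = even-slot (slotOf u) refl , odd-slot (slotOf v) refl
    where
    even-slot : ∀ s → slotOf u ≡ s → Σ (Fin n) (λ k → slotOf u ≡ (k , 0F))
    even-slot (k , 0F) eq = k , eq
    even-slot (k , 1F) eq =
      ⊥-elim (height≤2 (bottom k) u v (subst (bottom k ≺_) (sym (elementAt-slotOf eq)) (bottom≺top k)) u≺v)
    odd-slot : ∀ s → slotOf v ≡ s → Σ (Fin n) (λ k → slotOf v ≡ (k , 1F))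
    odd-slot (k , 0F) eq =
      ⊥-elim (height≤2 u v (top k) u≺v (subst (_≺ top k) (sym (elementAt-slotOf eq)) (bottom≺top k)))
    odd-slot (k , 1F) eq = k , eq

  -- A pair of permutations of Fin n, encoded as one map on Fin (n + n) so that it is counted by count-take×drop.
  HalvesInjective : Pred (Fin (n + n) → Fin n) 0ℓ
  HalvesInjective h = IsInjective (Vector.take n h) × IsInjective (Vector.drop n h)

  halvesInjective? : Decidable HalvesInjective
  halvesInjective? h = injective? (Vector.take n h) ×-dec injective? (Vector.drop n h)

  -- All bottoms before all tops, each group ordered by one half of h.
  spread : (Fin (n + n) → Fin n) → Fin n × Fin 2 → Fin (2 * n)
  spread h (k , 0F) = Vector.take n h k ↑ˡ (n + 0)
  spread h (k , 1F) = n ↑ʳ (Vector.drop n h k ↑ˡ 0)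

  spread-bottom<top : ∀ h k k′ → spread h (k , 0F) Fin.< spread h (k′ , 1F)
  spread-bottom<top h k k′ = begin-strict
    toℕ (Vector.take n h k ↑ˡ (n + 0))       ≡⟨ toℕ-↑ˡ _ (n + 0) ⟩
    toℕ (Vector.take n h k)                  <⟨ toℕ<n _ ⟩
    n                                        ≤⟨ ℕ.m≤m+n n _ ⟩
    n + toℕ (Vector.drop n h k′ ↑ˡ 0)        ≡⟨ toℕ-↑ʳ n _ ⟨
    toℕ (n ↑ʳ (Vector.drop n h k′ ↑ˡ 0))     ∎
    where open ℕ.≤-Reasoning

  spread-injective : ∀ {h} → HalvesInjective h → ∀ s s′ → spread h s ≡ spread h s′ → s ≡ s′
  spread-injective (inj-take , _) (k , 0F) (k′ , 0F) eq = cong (_, 0F) (inj-take k k′ (↑ˡ-injective (n + 0) _ _ eq))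
  spread-injective {h} _ (k , 0F) (k′ , 1F) eq = contradiction eq (<⇒≢ (spread-bottom<top h k k′))
  spread-injective {h} _ (k , 1F) (k′ , 0F) eq = contradiction (sym eq) (<⇒≢ (spread-bottom<top h k′ k))
  spread-injective (_ , inj-drop) (k , 1F) (k′ , 1F) eq =
    cong (_, 1F) (inj-drop k k′ (↑ˡ-injective 0 _ _ (↑ʳ-injective n _ _ eq)))

  extension : (Fin (n + n) → Fin n) → Fin (2 * n) → Fin (2 * n)
  extension h = spread h ∘ slotOf

  extension-linear : ∀ {h} → HalvesInjective h → IsLinearExtension P (extension h)
  extension-linear {h} halves-inj =
    (λ x y → slotOf-injective ∘ spread-injective halves-inj (slotOf x) (slotOf y)) ,
    λ u v u≺v → let (k , u-even) , (k′ , v-odd) = related-slots u≺v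
                in subst₂ (λ s s′ → spread h s Fin.< spread h s′) (sym u-even) (sym v-odd) (spread-bottom<top h k k′)

  extension-elementAt : ∀ h k b → extension h (elementAt (slot k b)) ≡ spread h (k , b)
  extension-elementAt h k b = cong (spread h) (slotOf-elementAt k b)

  extension-injective : ∀ h h′ → extension h ≗ extension h′ → h ≗ h′
  extension-injective h h′ eq z = subst (λ w → h w ≡ h′ w) (join-splitAt n n z) (by-half (splitAt n z))
    where
    same-spread : ∀ k b → spread h (k , b) ≡ spread h′ (k , b)
    same-spread k b = trans (sym (extension-elementAt h k b)) (trans (eq _) (extension-elementAt h′ k b))
    by-half : ∀ s → h (join n n s) ≡ h′ (join n n s)
    by-half (inj₁ k) = ↑ˡ-injective (n + 0) _ _ (same-spread k 0F)
    by-half (inj₂ k) = ↑ˡ-injective 0 _ _ (↑ʳ-injective n _ _ (same-spread k 1F))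

  lower-bound : n ! * n ! ≤ e P
  lower-bound = begin
    n ! * n !
      ≡⟨ cong₂ _*_ (count-permutations n) (count-permutations n) ⟨
    count (injective? {n} {n}) * count (injective? {n} {n})
      ≡⟨ count-take×drop n injective? injective? injective-resp injective-resp ⟨
    count halvesInjective?
      ≤⟨ count-≤-injection halvesInjective? (isLinearExtension? P) (linearExtension-resp P)
           (λ h _ → extension h) (λ _ → extension-linear) (λ h h′ _ _ → extension-injective h h′) ⟩
    count (isLinearExtension? P)
      ≡⟨ e≡count P ⟨
    e P
      ∎
    where open ℕ.≤-Reasoning

  upper-bound : e P ≤ n ! * oddDoubleFact n
  upper-bound = ℕ.*-cancelʳ-≤ (e P) (n ! * oddDoubleFact n) (2 ^ n) {{ℕ.m^n≢0 2 n}} (begin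
    e P * 2 ^ n
      ≡⟨ cong (_* 2 ^ n) (e≡count P) ⟩
    count (isLinearExtension? P) * 2 ^ n
      ≤⟨ ℕ.*-monoˡ-≤ (2 ^ n) (count-mono (isLinearExtension? P) ordered-injective? linear⇒ordered) ⟩
    count ordered-injective? * 2 ^ n
      ≡⟨ cong (λ l → count ordered-injective? * 2 ^ l) (length-tabulate {n = n} id) ⟨
    count ordered-injective? * 2 ^ length (allFin n)
      ≡⟨ count-injective-ordered bottom top bottom-injective top-injective bottom≢top (allFin n) (allFin⁺ n) ⟨
    count (injective? {2 * n} {2 * n})
      ≡⟨ count-permutations (2 * n) ⟩
    (2 * n) !
      ≡⟨ double-factorial n ⟩
    n ! * oddDoubleFact n * 2 ^ n
      ∎)
    where
    open ℕ.≤-Reasoning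
    ordered-injective? : Decidable (IsInjective ∩ Ordered bottom top (allFin n))
    ordered-injective? = injective? ∩? ordered? bottom top (allFin n)
    linear⇒ordered : IsLinearExtension P ⊆ (IsInjective ∩ Ordered bottom top (allFin n))
    linear⇒ordered (inj , mono) = inj , All.tabulate (λ {k} _ → mono (bottom k) (top k) (bottom≺top k))

mainTheorem8 : (n : ℕ) (P : StrictPoset (2 * n)) → HasHeight≤2 P → e P % 2 ≡ 1 →
    ((n !) * (n !) ≤ e P) × (e P ≤ (n !) * oddDoubleFact n)
mainTheorem8 n P height≤2 odd =
  let _ , ℓ₀-linear , ℓ₀-matched = odd⇒matchedExtension P odd
      open MatchedExtension {n} P height≤2 ℓ₀-linear ℓ₀-matched
  in lower-bound , upper-bound
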